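{- Let $F$ be a species. For every finite set $U$ there is a bijection between $F^{\blacktriangleright}[U]$ and $\mathcal{T}_F[U]$, where $F^{\blacktriangleright}$ is the parking-like species over $F$ associated to the identity map and $\mathcal{T}_F$ is the tree-like species over $F$.
   Context: Species: a species $G$ assigns to each finite set $U$ a finite set $G[U]$ of structures (functorially in bijections). Sum: $(G+H)[U]=G[U]\sqcup H[U]$. Product: $(G\cdot H)[U]=\bigsqcup_{U=V\sqcup W}G[V]\times H[W]$. Powers: $G^0=\mathbf{1}$ (with $\mathbf{1}[U]=\{U\}$ if $U=\emptyset$, else $\emptyset$), $G^k=G\cdot G^{k-1}$. Restriction: $(G)_m[U]=G[U]$ if $|U|=m$, else $\emptyset$. Singleton species $X$: $X[U]=\{U\}$ if $|U|=1$, else $\emptyset$. Composition (for $H[\emptyset]=\emptyset$): a $G(H)$-structure on $U$ is a partition $\pi$ of $U$ together with a $G$-structure on the set of blocks of $\pi$ and an $H$-structure on each block. For a non-decreasing $\chi:\mathbb{N}_{>0}\to\mathbb{N}$, the parking-like species $F^{\chi}$ is defined recursively by $F^{\chi}:=\left(F^{\chi(1)}\right)_0+\sum_{m\ge1}\left(F^{\chi(1)}\right)_m\cdot F^{\rho_m}$ with $\rho_m:k\mapsto\chi(m+k)-\chi(1)$; $F^{\blacktriangleright}:=F^{\mathrm{Id}}$. The tree-like species $\mathcal{T}_F$ is the species defined by the recursive equation $\mathcal{T}_F=F(X\cdot\mathcal{T}_F)$. -}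

module Defs where

open import Data.Nat using (ℕ; zero; suc; _+_; _∸_; _≤_)
open import Data.Fin using (Fin)
open import Data.Fin.Subset using (Subset; ∣_∣)
open import Data.Fin.Permutation using (Permutation′; id; _∘ₚ_)
open import Data.Vec using (Vec; []; _∷_; _∷ʳ_; updateAt)
open import Data.Product using (Σ; _×_)
open import Function.Bundles using (_↔_)
open import Relation.Binary.PropositionalEquality using (_≡_)

-- Every finite set U is in bijection with Fin n (n = |U|), and a
-- species is functorial in bijections, so a species is determined by its
-- structures on the canonical sets Fin n together with the action of the
-- permutations of Fin n.

record Species : Set₁ where
  field
    obj       : ℕ → Set
    card      : ℕ → ℕ
    finite    : ∀ n → obj n ↔ Fin (card n)
    transport : ∀ {n} → Permutation′ n → obj n → obj n
    transport-id : ∀ {n} (x : obj n) → transport id x ≡ x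
    transport-∘  : ∀ {n} (π σ : Permutation′ n) (x : obj n) →
                   transport (π ∘ₚ σ) x ≡ transport σ (transport π x)

open Species public

-- Structure families: S n = set of structures on the n-element set Fin n.
Fam : Set₁
Fam = ℕ → Set

𝟙 : Fam
𝟙 n = n ≡ 0

𝕏 : Fam
𝕏 n = n ≡ 1

-- Product: a decomposition U = V ⊔ W is a subset V of Fin n (W its
-- complement); V and W are identified with Fin |V|, Fin |W| in an
-- order-preserving way.
_·_ : Fam → Fam → Fam
(G · H) n = Σ (Subset n) λ V → G ∣ V ∣ × H (n ∸ ∣ V ∣)

pow : Fam → ℕ → Fam
pow G zero    = 𝟙
pow G (suc k) = G · pow G k

-- Parking-like species F^χ.  χ : ℕ>0 → ℕ is represented by a function
-- ℕ → ℕ of which only the values at positive arguments are used.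

ρ : (ℕ → ℕ) → ℕ → (ℕ → ℕ)
ρ χ m k = χ (m + k) ∸ χ 1

-- F^χ = (F^{χ(1)})_0 + Σ_{m≥1} (F^{χ(1)})_m · F^{ρ_m}
data Park (F : Species) : (ℕ → ℕ) → ℕ → Set where
  base : ∀ {χ} → pow (obj F) (χ 1) 0 → Park F χ 0
  step : ∀ {χ n} (V : Subset n) → 1 ≤ ∣ V ∣ →
         pow (obj F) (χ 1) ∣ V ∣ →
         Park F (ρ χ ∣ V ∣) (n ∸ ∣ V ∣) → Park F χ n

ParkId : Species → Fam
ParkId F = Park F (λ k → k)

-- Set partitions of Fin n into k (nonempty) blocks, canonically encoded
-- as restricted growth strings: elements 0,1,…,n-1 are inserted in
-- order; each either opens a new block or joins an existing one.  Blocks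
-- are numbered by their least element.

data Partition : ℕ → ℕ → Set where
  []  : Partition 0 0
  new : ∀ {n k} → Partition n k → Partition (suc n) (suc k)
  old : ∀ {n k} → Fin k → Partition n k → Partition (suc n) k

blockSizes : ∀ {n k} → Partition n k → Vec ℕ k
blockSizes []        = []
blockSizes (new π)   = blockSizes π ∷ʳ 1
blockSizes (old i π) = updateAt (blockSizes π) i suc

-- Tree-like species  T_F = F(X · T_F), as the (well-founded) solution:
-- a T_F-structure on Fin n is a partition π of Fin n, an F-structure on
-- the set of blocks of π, and an (X · T_F)-structure on each block.

data Tree (F : Species) : ℕ → Set
data Blocks (F : Species) : ∀ {k} → Vec ℕ k → Set

data Tree F where
  node : ∀ {n k} (π : Partition n k) → obj F k →
         Blocks F (blockSizes π) → Tree F n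

data Blocks F where
  []  : Blocks F []
  _∷_ : ∀ {s k} {ss : Vec ℕ k} →
        (Σ (Subset s) λ V → 𝕏 ∣ V ∣ × Tree F (s ∸ ∣ V ∣)) →
        Blocks F ss → Blocks F (s ∷ ss)

-- Write T for T_F. A T-structure is an F-structure on the blocks of a set partition whose blocks
-- carry a root and a subtree structure on the rest. Listing the k blocks in all k! orders gives
-- (X·T)^k = X^k·T^k, and X^k[a] consists of the k! orderings of a k-set; cancelling k! (all sets
-- involved are finite) gives T[n] ≅ Σ_{a+b=n} F[a] × T^a[b]: an F-structure on the roots and a
-- tuple of subtrees. This description is multiplicative, so T^c[n] ≅ Σ_{a+b=n} F^c[a] × T^a[b].
-- If χ(m) = c + m − 1 then every ρ_m χ has the same shape with c = m, and the defining recursion of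
-- F^χ is exactly this sum (split by a = 0 or a ≥ 1); by strong induction F^χ ≅ T^c, and χ = Id is
-- the case c = 1.
module Submission where

open import Data.Bool using (true; false)
open import Data.Empty using (⊥; ⊥-elim)
open import Data.Fin using (Fin)
open import Data.Fin.Permutation using (↔⇒≡)
open import Data.Fin.Properties using (0↔⊥; +↔⊎; *↔×)
open import Data.Fin.Subset using (Subset; ∣_∣)
open import Data.Fin.Subset.Properties using (∣p∣≤n)
open import Data.Nat using (ℕ; zero; suc; pred; _+_; _*_; _!; _∸_; _≤_; _<_; z≤n; s≤s; _≟_; NonZero)
open import Data.Nat.Induction using (<-rec)
open import Data.Nat.Properties
  using (_!≢0; +-suc; +-identityʳ; +-∸-assoc; m+n∸m≡n; *-cancelˡ-≡; suc-injective; ≡-irrelevant;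
         ≤-pred; ≤-trans; m≤n⇒m≤1+n)
open import Data.Product using (Σ; _×_; _,_; proj₁; proj₂)
import Data.Product.Function.Dependent.Propositional as Σ
open import Data.Product.Function.NonDependent.Propositional using (_×-↔_)
open import Data.Sum using (_⊎_; inj₁; inj₂)
open import Data.Sum.Function.Propositional using (_⊎-↔_)
open import Data.Unit using (⊤)
open import Data.Vec using (Vec; []; _∷_; _∷ʳ_; init; last; updateAt; replicate)
open import Defs
open import Function using (_∘_; case_of_)
open import Function.Bundles using (_↔_; mk↔ₛ′; Inverse)
open import Function.Properties.Inverse using (↔-refl; ↔-sym; ↔-trans)
open import Function.Related.Propositional using (bijection; ≡⇒)
open import Function.Related.TypeIsomorphisms
  using (Σ-assoc; ∃∃↔∃∃; ∃-≡; ×-comm; ×-distribˡ-⊎; Σ-distribˡ-⊎; ⊎-comm; ⊎-assoc)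
open import Relation.Binary.PropositionalEquality
  using (_≡_; refl; cong; cong₂; trans; sym; module ≡-Reasoning)
open import Relation.Nullary using (¬_; yes; no)

private variable
  A B : Set
  a b n : ℕ
  Q R : ℕ → ℕ → Set
  G G′ H H′ K : Fam

infixr 0 _⨾_
_⨾_ : {C : Set} → A ↔ B → B ↔ C → A ↔ C
_⨾_ = ↔-trans

↔-subst : {I : Set} (P : I → Set) {x y : I} → x ≡ y → P x ↔ P y
↔-subst P eq = ≡⇒ {k = bijection} (cong P eq)

Σ-cong : {I : Set} {P P′ : I → Set} → (∀ {i} → P i ↔ P′ i) → Σ I P ↔ Σ I P′
Σ-cong = Σ.congˡ {k = bijection}

↔-empty : ¬ A → ¬ B → A ↔ B
↔-empty ¬a ¬b = mk↔ₛ′ (⊥-elim ∘ ¬a) (⊥-elim ∘ ¬b) (⊥-elim ∘ ¬b) (⊥-elim ∘ ¬a)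

⊎-emptyˡ : ¬ A → (A ⊎ B) ↔ B
⊎-emptyˡ ¬a = mk↔ₛ′ (λ { (inj₁ x) → ⊥-elim (¬a x) ; (inj₂ y) → y }) inj₂ (λ _ → refl)
  (λ { (inj₁ x) → ⊥-elim (¬a x) ; (inj₂ y) → refl })

⊎-emptyʳ : ¬ B → (A ⊎ B) ↔ A
⊎-emptyʳ ¬b = ⊎-comm _ _ ⨾ ⊎-emptyˡ ¬b

×-interchange : {C D : Set} → ((A × B) × (C × D)) ↔ ((A × C) × (B × D))
×-interchange = Σ-assoc ⨾ ↔-refl ×-↔ ∃∃↔∃∃ _ ⨾ ↔-sym Σ-assoc

Fin1-× : (Fin 1 × A) ↔ A
Fin1-× = mk↔ₛ′ proj₂ (Fin.zero ,_) (λ _ → refl) (λ { (Fin.zero , _) → refl ; (Fin.suc () , _) })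

Σ-Fin-suc : ∀ {k} {P : Fin (suc k) → Set} → Σ (Fin (suc k)) P ↔ (P Fin.zero ⊎ Σ (Fin k) (P ∘ Fin.suc))
Σ-Fin-suc = mk↔ₛ′
  (λ { (Fin.zero , p) → inj₁ p ; (Fin.suc i , p) → inj₂ (i , p) })
  (λ { (inj₁ p) → Fin.zero , p ; (inj₂ (i , p)) → Fin.suc i , p })
  (λ { (inj₁ _) → refl ; (inj₂ _) → refl })
  (λ { (Fin.zero , p) → refl ; (Fin.suc i , p) → refl })

Σℕ-uncons : {P : ℕ → Set} → Σ ℕ P ↔ (P 0 ⊎ Σ ℕ (P ∘ suc))
Σℕ-uncons = mk↔ₛ′
  (λ { (zero , p) → inj₁ p ; (suc k , p) → inj₂ (k , p) })
  (λ { (inj₁ p) → 0 , p ; (inj₂ (k , p)) → suc k , p })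
  (λ { (inj₁ _) → refl ; (inj₂ _) → refl })
  (λ { (zero , p) → refl ; (suc k , p) → refl })

≡↔≡ : {x y u v : ℕ} → (x ≡ y → u ≡ v) → (u ≡ v → x ≡ y) → (x ≡ y) ↔ (u ≡ v)
≡↔≡ f g = mk↔ₛ′ f g (λ _ → ≡-irrelevant _ _) (λ _ → ≡-irrelevant _ _)

↔-zero-or-positive : ∀ a → A ↔ (((a ≡ 0) × A) ⊎ ((1 ≤ a) × A))
↔-zero-or-positive zero    =
  mk↔ₛ′ (λ x → inj₁ (refl , x)) (λ { (inj₁ (_ , x)) → x ; (inj₂ (_ , x)) → x })
        (λ { (inj₁ (refl , _)) → refl ; (inj₂ (() , _)) }) (λ _ → refl)
↔-zero-or-positive (suc a) =
  mk↔ₛ′ (λ x → inj₂ (s≤s z≤n , x)) (λ { (inj₁ (_ , x)) → x ; (inj₂ (_ , x)) → x })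
        (λ { (inj₁ (() , _)) ; (inj₂ (s≤s z≤n , _)) → refl }) (λ _ → refl)

-- Shuffles and the convolution of species

-- A shuffle lists the elements of Fin n in increasing order, each marked as belonging to the left
-- or to the right part; it encodes a subset without the truncated subtraction n ∸ ∣ V ∣.
data Shuffle : ℕ → ℕ → ℕ → Set where
  []    : Shuffle 0 0 0
  left  : Shuffle a b n → Shuffle (suc a) b (suc n)
  right : Shuffle a b n → Shuffle a (suc b) (suc n)

shuffle-+ : Shuffle a b n → n ≡ a + b
shuffle-+ []                    = refl
shuffle-+ (left s)              = cong suc (shuffle-+ s)
shuffle-+ {a} {suc b} (right s) = trans (cong suc (shuffle-+ s)) (sym (+-suc a b))

shuffle-≤ˡ : Shuffle a b n → a ≤ n
shuffle-≤ˡ []        = z≤n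
shuffle-≤ˡ (left s)  = s≤s (shuffle-≤ˡ s)
shuffle-≤ˡ (right s) = m≤n⇒m≤1+n (shuffle-≤ˡ s)

shuffle-≤ʳ : Shuffle a b n → b ≤ n
shuffle-≤ʳ []        = z≤n
shuffle-≤ʳ (left s)  = m≤n⇒m≤1+n (shuffle-≤ʳ s)
shuffle-≤ʳ (right s) = s≤s (shuffle-≤ʳ s)

shuffle-<ʳ : Shuffle a b n → 1 ≤ a → b < n
shuffle-<ʳ (left s)  _   = s≤s (shuffle-≤ʳ s)
shuffle-<ʳ (right s) 1≤a = s≤s (shuffle-<ʳ s 1≤a)

Split : ℕ → (ℕ → ℕ → Set) → Set
Split n Q = Σ ℕ λ a → Σ ℕ λ b → Shuffle a b n × Q a b

Split-cong : (∀ {a b} → Shuffle a b n → Q a b ↔ R a b) → Split n Q ↔ Split n R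
Split-cong e = Σ-cong (Σ-cong (Σ-cong λ {s} → e s))

Split-zero : ∀ {Q : ℕ → ℕ → Set} → Split 0 Q ↔ Q 0 0
Split-zero {Q} = mk↔ₛ′ to (λ q → 0 , 0 , [] , q) (λ _ → refl) from∘to
  where
  to : Split 0 Q → Q 0 0
  to (_ , _ , [] , q) = q
  from∘to : ∀ x → (0 , 0 , [] , to x) ≡ x
  from∘to (_ , _ , [] , q) = refl

Split-suc : ∀ {n} {Q : ℕ → ℕ → Set} →
  Split (suc n) Q ↔ (Split n (λ a b → Q (suc a) b) ⊎ Split n (λ a b → Q a (suc b)))
Split-suc {n} {Q} = mk↔ₛ′ to from to∘from from∘to
  where
  to : Split (suc n) Q → Split n (λ a b → Q (suc a) b) ⊎ Split n (λ a b → Q a (suc b))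
  to (_ , _ , left s , q)  = inj₁ (_ , _ , s , q)
  to (_ , _ , right s , q) = inj₂ (_ , _ , s , q)
  from : Split n (λ a b → Q (suc a) b) ⊎ Split n (λ a b → Q a (suc b)) → Split (suc n) Q
  from (inj₁ (a , b , s , q)) = suc a , b , left s , q
  from (inj₂ (a , b , s , q)) = a , suc b , right s , q
  to∘from : ∀ x → to (from x) ≡ x
  to∘from (inj₁ _) = refl
  to∘from (inj₂ _) = refl
  from∘to : ∀ x → from (to x) ≡ x
  from∘to (_ , _ , left s , q)  = refl
  from∘to (_ , _ , right s , q) = refl

Split-⊎ : Split n (λ a b → Q a b ⊎ R a b) ↔ (Split n Q ⊎ Split n R)
Split-⊎ = Σ-cong (Σ-cong ×-distribˡ-⊎ ⨾ Σ-distribˡ-⊎) ⨾ Σ-distribˡ-⊎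

Split-Σ : {I : Set} {P : I → ℕ → ℕ → Set} → Split n (λ a b → Σ I λ i → P i a b) ↔ Σ I λ i → Split n (P i)
Split-Σ = mk↔ₛ′ (λ (a , b , s , i , p) → i , a , b , s , p) (λ (i , a , b , s , p) → a , b , s , i , p)
  (λ _ → refl) (λ _ → refl)

Split-×ˡ : Split n (λ a b → A × Q a b) ↔ (A × Split n Q)
Split-×ˡ = mk↔ₛ′ (λ (a , b , s , x , q) → x , a , b , s , q) (λ (x , a , b , s , q) → a , b , s , x , q)
  (λ _ → refl) (λ _ → refl)

Split-×ʳ : Split n (λ a b → Q a b × A) ↔ (Split n Q × A)
Split-×ʳ = mk↔ₛ′ (λ (a , b , s , q , x) → (a , b , s , q) , x) (λ ((a , b , s , q) , x) → a , b , s , q , x)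
  (λ _ → refl) (λ _ → refl)

Split-×-Split : ∀ {x y} → (Split x Q × Split y R) ↔ Split x (λ a b → Split y λ c d → Q a b × R c d)
Split-×-Split = ↔-sym Split-×ʳ ⨾ Split-cong (λ _ → ↔-sym Split-×ˡ)

Split-comm : ∀ n {Q : ℕ → ℕ → Set} → Split n Q ↔ Split n (λ a b → Q b a)
Split-comm zero    = Split-zero ⨾ ↔-sym Split-zero
Split-comm (suc n) = Split-suc ⨾ Split-comm n ⊎-↔ Split-comm n ⨾ ⊎-comm _ _ ⨾ ↔-sym Split-suc

Split-identityˡ : ∀ n {Q : ℕ → ℕ → Set} → Split n (λ a b → (a ≡ 0) × Q a b) ↔ Q 0 n
Split-identityˡ zero    = Split-zero ⨾ mk↔ₛ′ proj₂ (refl ,_) (λ _ → refl) λ { (refl , _) → refl }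
Split-identityˡ (suc n) = Split-suc ⨾ ⊎-emptyˡ (λ { (_ , _ , _ , () , _) }) ⨾ Split-identityˡ n

Split-assoc : ∀ n {Q : ℕ → ℕ → ℕ → Set} →
  Split n (λ a b → Split a λ x y → Q x y b) ↔ Split n (λ x c → Split c λ y b → Q x y b)
Split-assoc zero    = Split-zero ⨾ Split-zero ⨾ ↔-sym (Split-zero ⨾ Split-zero)
Split-assoc (suc n) =
  Split-suc ⨾ suc-inside (λ a _ → a) ⊎-↔ ↔-refl
  ⨾ (Split-assoc n ⊎-↔ Split-assoc n) ⊎-↔ Split-assoc n
  ⨾ ⊎-assoc _ _ _ _
  ⨾ ↔-refl ⊎-↔ ↔-sym (suc-inside (λ _ c → c))
  ⨾ ↔-sym Split-suc
  where
  suc-inside : ∀ (i : ℕ → ℕ → ℕ) {P : ℕ → ℕ → ℕ → ℕ → Set} →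
    Split n (λ a b → Split (suc (i a b)) (P a b)) ↔
    (Split n (λ a b → Split (i a b) λ x y → P a b (suc x) y) ⊎
     Split n (λ a b → Split (i a b) λ x y → P a b x (suc y)))
  suc-inside _ = Split-cong (λ _ → Split-suc) ⨾ Split-⊎

Split-interchange : ∀ n {Q : ℕ → ℕ → ℕ → ℕ → Set} →
  Split n (λ a b → Split a λ x y → Split b λ z w → Q x y z w) ↔
  Split n (λ c d → Split c λ x z → Split d λ y w → Q x y z w)
Split-interchange n =
  Split-assoc n
  ⨾ Split-cong (λ {_} {c} _ → ↔-sym (Split-assoc c) ⨾ Split-cong (λ {z} _ → Split-comm z) ⨾ Split-assoc c)
  ⨾ ↔-sym (Split-assoc n)

infix 4 _≅_
_≅_ : Fam → Fam → Set
G ≅ H = ∀ {n} → G n ↔ H n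

infixr 7 _⊙_
_⊙_ : Fam → Fam → Fam
(G ⊙ H) n = Split n λ a b → G a × H b

power : Fam → ℕ → Fam
power G zero    = 𝟙
power G (suc k) = G ⊙ power G k

⊙-cong : G ≅ G′ → H ≅ H′ → G ⊙ H ≅ G′ ⊙ H′
⊙-cong e f = Split-cong λ _ → e ×-↔ f

⊙-comm : G ⊙ H ≅ H ⊙ G
⊙-comm = Split-comm _ ⨾ Split-cong (λ _ → ×-comm _ _)

⊙-assoc : G ⊙ (H ⊙ K) ≅ (G ⊙ H) ⊙ K
⊙-assoc {n = n} =
  Split-cong (λ _ → ↔-sym Split-×ˡ)
  ⨾ ↔-sym (Split-assoc n)
  ⨾ Split-cong (λ _ → Split-cong (λ _ → ↔-sym Σ-assoc) ⨾ Split-×ʳ)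

⊙-identityˡ : 𝟙 ⊙ G ≅ G
⊙-identityˡ = Split-identityˡ _

⊙-identityʳ : G ⊙ 𝟙 ≅ G
⊙-identityʳ = ⊙-comm ⨾ ⊙-identityˡ

⊙-lcomm : G ⊙ (H ⊙ K) ≅ H ⊙ (G ⊙ K)
⊙-lcomm = ⊙-assoc ⨾ ⊙-cong ⊙-comm ↔-refl ⨾ ↔-sym ⊙-assoc

power-+ : ∀ a b → power G (a + b) ≅ power G a ⊙ power G b
power-+ zero    b = ↔-sym ⊙-identityˡ
power-+ (suc a) b = ⊙-cong ↔-refl (power-+ a b) ⨾ ⊙-assoc

power-shuffle : ∀ {m} → Shuffle a b m → power H m ≅ power H a ⊙ power H b
power-shuffle {a = a} {b = b} {H = H} s {n} = ↔-subst (λ m → power H m n) (shuffle-+ s) ⨾ power-+ a b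

power-⊙ : ∀ k → power (G ⊙ H) k ≅ power G k ⊙ power H k
power-⊙ zero        = ↔-sym ⊙-identityˡ
power-⊙ (suc k) {n} =
  Split-cong (λ _ → ↔-refl ×-↔ power-⊙ k ⨾ Split-×-Split)
  ⨾ Split-interchange n
  ⨾ ↔-sym (Split-cong (λ _ → Split-×-Split ⨾ Split-cong (λ _ → Split-cong (λ _ → ×-interchange))))

Σ-Subset-suc : {P : Subset (suc n) → Set} →
  Σ (Subset (suc n)) P ↔ (Σ (Subset n) (λ V → P (true ∷ V)) ⊎ Σ (Subset n) (λ V → P (false ∷ V)))
Σ-Subset-suc = mk↔ₛ′
  (λ { (true ∷ V , p) → inj₁ (V , p) ; (false ∷ V , p) → inj₂ (V , p) })
  (λ { (inj₁ (V , p)) → true ∷ V , p ; (inj₂ (V , p)) → false ∷ V , p })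
  (λ { (inj₁ _) → refl ; (inj₂ _) → refl })
  (λ { (true ∷ V , p) → refl ; (false ∷ V , p) → refl })

Subset↔Split : ∀ n {Q} → Σ (Subset n) (λ V → Q ∣ V ∣ (n ∸ ∣ V ∣)) ↔ Split n Q
Subset↔Split zero        =
  mk↔ₛ′ (λ { ([] , q) → q }) ([] ,_) (λ _ → refl) (λ { ([] , q) → refl }) ⨾ ↔-sym Split-zero
Subset↔Split (suc n) {Q} =
  Σ-Subset-suc
  ⨾ Subset↔Split n ⊎-↔ (Σ-cong (λ {V} → ↔-subst (Q ∣ V ∣) (+-∸-assoc 1 (∣p∣≤n V))) ⨾ Subset↔Split n)
  ⨾ ↔-sym Split-suc

·≅⊙ : G · H ≅ G ⊙ H
·≅⊙ {n = n} = Subset↔Split n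

pow≅power : ∀ G k → pow G k ≅ power G k
pow≅power G zero    = ↔-refl
pow≅power G (suc k) = ·≅⊙ ⨾ ⊙-cong ↔-refl (pow≅power G k)

Finite : Set → Set
Finite A = Σ ℕ λ m → A ↔ Fin m

Finite-↔ : A ↔ B → Finite A → Finite B
Finite-↔ e (m , f) = m , (↔-sym e ⨾ f)

Finite-¬ : ¬ A → Finite A
Finite-¬ ¬a = 0 , ↔-empty ¬a (Inverse.to 0↔⊥)

Finite-⊎ : Finite A → Finite B → Finite (A ⊎ B)
Finite-⊎ (m , e) (m′ , f) = m + m′ , (e ⊎-↔ f ⨾ ↔-sym +↔⊎)

Finite-× : Finite A → Finite B → Finite (A × B)
Finite-× (m , e) (m′ , f) = m * m′ , (e ×-↔ f ⨾ ↔-sym *↔×)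

Finite-×-dep : Finite A → (A → Finite B) → Finite (A × B)
Finite-×-dep (zero  , e) _   = Finite-¬ (Inverse.to 0↔⊥ ∘ Inverse.to e ∘ proj₁)
Finite-×-dep (suc m , e) fin = Finite-× (suc m , e) (fin (Inverse.from e Fin.zero))

Finite-≡ : (x y : ℕ) → Finite (x ≡ y)
Finite-≡ x y with x ≟ y
... | yes x≡y =
  1 , mk↔ₛ′ (λ _ → Fin.zero) (λ _ → x≡y) (λ { Fin.zero → refl ; (Fin.suc ()) }) (≡-irrelevant x≡y)
... | no x≢y  = Finite-¬ x≢y

Finite-Split : ∀ n → (∀ {a b} → Shuffle a b n → Finite (Q a b)) → Finite (Split n Q)
Finite-Split zero    fin = Finite-↔ (↔-sym Split-zero) (fin [])
Finite-Split (suc n) fin =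
  Finite-↔ (↔-sym Split-suc) (Finite-⊎ (Finite-Split n (fin ∘ left)) (Finite-Split n (fin ∘ right)))

Finite-Σℕ : ∀ N {P : ℕ → Set} → (∀ {k} → k ≤ N → Finite (P k)) → (∀ {k} → P k → k ≤ N) → Finite (Σ ℕ P)
Finite-Σℕ zero    fin bound =
  Finite-↔ (↔-sym Σℕ-uncons) (Finite-⊎ (fin z≤n) (Finite-¬ λ (_ , p) → case bound p of λ ()))
Finite-Σℕ (suc N) fin bound =
  Finite-↔ (↔-sym Σℕ-uncons) (Finite-⊎ (fin z≤n) (Finite-Σℕ N (fin ∘ s≤s) (≤-pred ∘ bound)))

Finite-power : (∀ m → Finite (G m)) → ∀ c n → Finite (power G c n)
Finite-power fin zero    n = Finite-≡ n 0
Finite-power fin (suc c) n = Finite-Split n λ {a} {b} _ → Finite-× (fin a) (Finite-power fin c b)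

×-cancelˡ-Fin : ∀ c .{{_ : NonZero c}} → Finite A → Finite B → (Fin c × A) ↔ (Fin c × B) → A ↔ B
×-cancelˡ-Fin c (m , e) (m′ , f) g = e ⨾ ↔-subst Fin m≡m′ ⨾ ↔-sym f
  where
  m≡m′ : m ≡ m′
  m≡m′ = *-cancelˡ-≡ m m′ c (↔⇒≡ (*↔× ⨾ ↔-refl ×-↔ ↔-sym e ⨾ g ⨾ ↔-refl ×-↔ f ⨾ ↔-sym *↔×))

-- Decorated set partitions

Decorated : ∀ {k} → Vec Fam k → Vec ℕ k → Set
Decorated []       []       = ⊤
Decorated (H ∷ Hs) (s ∷ ss) = H s × Decorated Hs ss

Decorated-∷ʳ : ∀ {k s} (Hs : Vec Fam (suc k)) (ss : Vec ℕ k) →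
  Decorated Hs (ss ∷ʳ s) ↔ (Decorated (init Hs) ss × last Hs s)
Decorated-∷ʳ (H ∷ [])      []       = ×-comm _ _
Decorated-∷ʳ (H ∷ H′ ∷ Hs) (s ∷ ss) = ↔-refl ×-↔ Decorated-∷ʳ (H′ ∷ Hs) ss ⨾ ↔-sym Σ-assoc

shiftAt : ∀ {k} → Vec Fam k → Fin k → Vec Fam k
shiftAt Hs i = updateAt Hs i (_∘ suc)

Decorated-updateAt : ∀ {k} (Hs : Vec Fam k) (ss : Vec ℕ k) i →
  Decorated Hs (updateAt ss i suc) ↔ Decorated (shiftAt Hs i) ss
Decorated-updateAt (H ∷ Hs) (s ∷ ss) Fin.zero    = ↔-refl
Decorated-updateAt (H ∷ Hs) (s ∷ ss) (Fin.suc i) = ↔-refl ×-↔ Decorated-updateAt Hs ss i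

VecIndexedFam : Set₁
VecIndexedFam = ∀ {k} → Vec Fam k → Fam

-- The recursion of Hs-decorated partitions on the largest element: it either forms a new last block
-- (decorated by last Hs), or it joins block i, whose decoration H then sees the rest of the block
-- through H ∘ suc.
NewBlock : VecIndexedFam → ∀ {k} → Vec Fam k → ℕ → Set
NewBlock S []         n = ⊥
NewBlock S Hs@(_ ∷ _) n = S (init Hs) n × last Hs 1

Step : VecIndexedFam → ∀ {k} → Vec Fam k → ℕ → Set
Step S {k} Hs n = NewBlock S Hs n ⊎ Σ (Fin k) λ i → S (shiftAt Hs i) n

Step-cong : {S S′ : VecIndexedFam} → (∀ {k} (Hs : Vec Fam k) → S Hs n ↔ S′ Hs n) →
  ∀ {k} (Hs : Vec Fam k) → Step S Hs n ↔ Step S′ Hs n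
Step-cong e []         = ↔-refl ⊎-↔ Σ-cong (e _)
Step-cong e Hs@(_ ∷ _) = (e (init Hs) ×-↔ ↔-refl) ⊎-↔ Σ-cong (e _)

Step-unique : {S S′ : VecIndexedFam} →
  (∀ {k} (Hs : Vec Fam k) → S Hs 0 ↔ S′ Hs 0) →
  (∀ {k n} (Hs : Vec Fam k) → S Hs (suc n) ↔ Step S Hs n) →
  (∀ {k n} (Hs : Vec Fam k) → S′ Hs (suc n) ↔ Step S′ Hs n) →
  ∀ n {k} (Hs : Vec Fam k) → S Hs n ↔ S′ Hs n
Step-unique at0 atsuc atsuc′ zero    Hs = at0 Hs
Step-unique at0 atsuc atsuc′ (suc n) Hs =
  atsuc Hs ⨾ Step-cong (Step-unique at0 atsuc atsuc′ n) Hs ⨾ ↔-sym (atsuc′ Hs)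

DecoratedPartition : VecIndexedFam
DecoratedPartition {k} Hs n = Σ (Partition n k) λ π → Decorated Hs (blockSizes π)

-- The same structures, described from the least element: it lies in the first block.
MinOrdered : VecIndexedFam
MinOrdered []       n       = n ≡ 0
MinOrdered (H ∷ Hs) zero    = ⊥
MinOrdered (H ∷ Hs) (suc n) = ((H ∘ suc) ⊙ MinOrdered Hs) n

Σ-Partition-suc : ∀ {n k} {P : Partition (suc n) (suc k) → Set} →
  Σ (Partition (suc n) (suc k)) P ↔
  (Σ (Partition n k) (P ∘ new) ⊎ Σ (Fin (suc k)) λ i → Σ (Partition n (suc k)) (P ∘ old i))
Σ-Partition-suc = mk↔ₛ′
  (λ { (new π , p) → inj₁ (π , p) ; (old i π , p) → inj₂ (i , π , p) })
  (λ { (inj₁ (π , p)) → new π , p ; (inj₂ (i , π , p)) → old i π , p })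
  (λ { (inj₁ _) → refl ; (inj₂ _) → refl })
  (λ { (new π , p) → refl ; (old i π , p) → refl })

DecoratedPartition-suc : ∀ {k n} (Hs : Vec Fam k) →
  DecoratedPartition Hs (suc n) ↔ Step DecoratedPartition Hs n
DecoratedPartition-suc []         = ↔-empty (λ { (old () _ , _) }) (λ { (inj₂ (() , _)) })
DecoratedPartition-suc Hs@(_ ∷ _) =
  Σ-Partition-suc
  ⨾ (Σ-cong (Decorated-∷ʳ Hs _) ⨾ ↔-sym Σ-assoc) ⊎-↔ Σ-cong (Σ-cong (Decorated-updateAt Hs _ _))

MinOrdered-suc : ∀ {k n} (Hs : Vec Fam k) → MinOrdered Hs (suc n) ↔ Step MinOrdered Hs n
MinOrdered-suc []                   = ↔-empty (λ ()) (λ { (inj₂ (() , _)) })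
MinOrdered-suc {n = zero}  (H ∷ Hs) =
  Split-zero ⨾ ↔-sym (⊎-emptyʳ (λ { (Fin.zero , ()) ; (Fin.suc _ , ()) }) ⨾ singleton-block Hs)
  where
  singleton-block : ∀ {k} (Hs : Vec Fam k) → NewBlock MinOrdered (H ∷ Hs) 0 ↔ (H 1 × MinOrdered Hs 0)
  singleton-block []      = ×-comm _ _
  singleton-block (_ ∷ _) = ↔-empty proj₁ proj₂
MinOrdered-suc {n = suc m} (H ∷ Hs) =
  Split-suc
  ⨾ ↔-refl ⊎-↔ (Split-cong (λ _ → ↔-refl ×-↔ MinOrdered-suc Hs ⨾ ×-distribˡ-⊎) ⨾ Split-⊎
               ⨾ new-block-after Hs ⊎-↔ (Split-cong (λ _ → ∃∃↔∃∃ _) ⨾ Split-Σ))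
  ⨾ ↔-sym (⊎-assoc _ _ _ _) ⨾ ⊎-comm _ _ ⊎-↔ ↔-refl ⨾ ⊎-assoc _ _ _ _
  ⨾ ↔-refl ⊎-↔ ↔-sym Σ-Fin-suc
  where
  new-block-after : ∀ {k} (Hs : Vec Fam k) →
    Split m (λ a b → H (suc a) × NewBlock MinOrdered Hs b) ↔ NewBlock MinOrdered (H ∷ Hs) (suc m)
  new-block-after []      = ↔-empty (λ { (_ , _ , _ , _ , ()) }) (λ { (() , _) })
  new-block-after (_ ∷ _) = Split-cong (λ _ → ↔-sym Σ-assoc) ⨾ Split-×ʳ

DecoratedPartition↔MinOrdered : ∀ n {k} (Hs : Vec Fam k) → DecoratedPartition Hs n ↔ MinOrdered Hs n
DecoratedPartition↔MinOrdered = Step-unique at0 DecoratedPartition-suc MinOrdered-suc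
  where
  at0 : ∀ {k} (Hs : Vec Fam k) → DecoratedPartition Hs 0 ↔ MinOrdered Hs 0
  at0 []      = mk↔ₛ′ (λ _ → refl) (λ _ → [] , _) (λ { refl → refl }) (λ { ([] , _) → refl })
  at0 (_ ∷ _) = ↔-empty (λ { (() , _) }) (λ ())

-- Assemblies: unordered tuples of H-structures

Assembly : ℕ → Fam → Fam
Assembly k H = MinOrdered (replicate k H)

Assembly-cong : H ≅ H′ → ∀ k → Assembly k H ≅ Assembly k H′
Assembly-cong e zero            = ↔-refl
Assembly-cong e (suc k) {zero}  = ↔-refl
Assembly-cong e (suc k) {suc n} = ⊙-cong e (Assembly-cong e k)

Assembly-bound : ∀ k {n} → Assembly k H n → k ≤ n
Assembly-bound zero    _                            = z≤n
Assembly-bound (suc k) {suc n} (_ , _ , s , _ , x) = s≤s (≤-trans (Assembly-bound k x) (shuffle-≤ʳ s))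

Finite-Assembly : ∀ k {n} → (∀ {m} → m ≤ n → Finite (H m)) → Finite (Assembly k H n)
Finite-Assembly zero    {n}     fin = Finite-≡ n 0
Finite-Assembly (suc k) {zero}  fin = Finite-¬ λ ()
Finite-Assembly (suc k) {suc n} fin = Finite-Split n λ s →
  Finite-× (fin (s≤s (shuffle-≤ˡ s)))
           (Finite-Assembly k λ m≤b → fin (≤-trans m≤b (m≤n⇒m≤1+n (shuffle-≤ʳ s))))

power-suc-suc : ∀ k {n} → power H (suc k) (suc n) ↔ (Fin (suc k) × ((H ∘ suc) ⊙ power H k) n)
power-suc-suc zero    = Split-suc ⨾ ⊎-emptyʳ (λ { (_ , _ , _ , _ , ()) }) ⨾ ↔-sym Fin1-×
power-suc-suc (suc k) =
  Split-suc
  ⨾ ↔-refl ⊎-↔ (Split-cong (λ _ → ↔-refl ×-↔ power-suc-suc k ⨾ ∃∃↔∃∃ _) ⨾ Split-×ˡ ⨾ ↔-refl ×-↔ ⊙-lcomm)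
  ⨾ ↔-sym Σ-Fin-suc

-- The k! orderings of the blocks of an assembly: the factor containing the least element can be
-- any of the k, and the remaining k − 1 factors are ordered recursively.
power-sorted : ¬ H 0 → ∀ k {n} → power H k n ↔ (Fin (k !) × Assembly k H n)
power-sorted ¬h zero            = ↔-sym Fin1-×
power-sorted ¬h (suc k) {zero}  = ↔-empty (¬h ∘ proj₁ ∘ Inverse.to Split-zero) proj₂
power-sorted ¬h (suc k) {suc n} =
  power-suc-suc k
  ⨾ ↔-refl ×-↔ (Split-cong (λ _ → ↔-refl ×-↔ power-sorted ¬h k ⨾ ∃∃↔∃∃ _) ⨾ Split-×ˡ)
  ⨾ ↔-sym Σ-assoc ⨾ ↔-sym *↔× ×-↔ ↔-refl

Assembly-𝕏 : ∀ k {m} → Assembly k 𝕏 m ↔ (k ≡ m)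
Assembly-𝕏 zero            = ≡↔≡ sym sym
Assembly-𝕏 (suc k) {zero}  = ↔-empty (λ ()) (λ ())
Assembly-𝕏 (suc k) {suc m} =
  Split-cong (λ _ → ≡↔≡ (cong pred) (cong suc) ×-↔ Assembly-𝕏 k)
  ⨾ Split-identityˡ m ⨾ ≡↔≡ (cong suc) suc-injective

Finite-𝕏⊙ : (∀ {m} → m < n → Finite (H m)) → ∀ {s} → s ≤ n → Finite ((𝕏 ⊙ H) s)
Finite-𝕏⊙ fin s≤n = Finite-Split _ λ {a} sh →
  Finite-×-dep (Finite-≡ a 1) λ { refl → fin (≤-trans (shuffle-<ʳ sh (s≤s z≤n)) s≤n) }

-- G(X·H), with the X-points (the roots) split off first; the a-tuple of H-structures is indexed by
-- the roots in increasing order.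
Grafting : Fam → Fam → Fam
Grafting G H n = Split n λ a b → G a × power H a b

Grafting-⊙ : Grafting G H ⊙ Grafting G′ H ≅ Grafting (G ⊙ G′) H
Grafting-⊙ {n = n} =
  Split-cong (λ _ → Split-×-Split)
  ⨾ ↔-sym (Split-interchange n)
  ⨾ ↔-sym (Split-cong (λ _ → ↔-sym Split-×ʳ)
           ⨾ Split-cong (λ _ → Split-cong λ s →
               ↔-refl ×-↔ power-shuffle s ⨾ ↔-sym Split-×ˡ ⨾ Split-cong (λ _ → ×-interchange)))

ShiftedId : ℕ → (ℕ → ℕ) → Set
ShiftedId c χ = ∀ k → χ (suc k) ≡ c + k

ρ-ShiftedId : ∀ {c χ} → ShiftedId c χ → ∀ m → ShiftedId m (ρ χ m)
ρ-ShiftedId {c} {χ} shifted m k = begin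
  χ (m + suc k) ∸ χ 1    ≡⟨ cong (λ x → χ x ∸ χ 1) (+-suc m k) ⟩
  χ (suc (m + k)) ∸ χ 1  ≡⟨ cong₂ _∸_ (shifted (m + k)) (trans (shifted 0) (+-identityʳ c)) ⟩
  (c + (m + k)) ∸ c      ≡⟨ m+n∸m≡n c (m + k) ⟩
  m + k                  ∎
  where open ≡-Reasoning

module _ (F : Species) where

  Blocks↔Decorated : ∀ {k} (ss : Vec ℕ k) → Blocks F ss ↔ Decorated (replicate k (𝕏 · Tree F)) ss
  Blocks↔Decorated ss = mk↔ₛ′ to (from ss) (to∘from ss) from∘to
    where
    to : ∀ {k} {ss : Vec ℕ k} → Blocks F ss → Decorated (replicate k (𝕏 · Tree F)) ss
    to []       = _
    to (x ∷ bs) = x , to bs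
    from : ∀ {k} (ss : Vec ℕ k) → Decorated (replicate k (𝕏 · Tree F)) ss → Blocks F ss
    from []       _        = []
    from (_ ∷ ss) (x , xs) = x ∷ from ss xs
    to∘from : ∀ {k} (ss : Vec ℕ k) xs → to (from ss xs) ≡ xs
    to∘from []       _        = refl
    to∘from (_ ∷ ss) (x , xs) = cong (x ,_) (to∘from ss xs)
    from∘to : ∀ {k} {ss : Vec ℕ k} (bs : Blocks F ss) → from ss (to bs) ≡ bs
    from∘to []       = refl
    from∘to (x ∷ bs) = cong (x ∷_) (from∘to bs)

  Tree↔Σ-Assembly : Tree F n ↔ Σ ℕ λ k → obj F k × Assembly k (𝕏 ⊙ Tree F) n
  Tree↔Σ-Assembly {n} =
    mk↔ₛ′ (λ { (node π f bs) → _ , f , π , bs }) (λ (_ , f , π , bs) → node π f bs)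
          (λ _ → refl) (λ { (node _ _ _) → refl })
    ⨾ Σ-cong (↔-refl ×-↔ (Σ-cong (Blocks↔Decorated _)
                          ⨾ DecoratedPartition↔MinOrdered n _
                          ⨾ Assembly-cong ·≅⊙ _))

  Finite-Tree : ∀ n → Finite (Tree F n)
  Finite-Tree = <-rec _ λ n rec →
    Finite-↔ (↔-sym Tree↔Σ-Assembly)
      (Finite-Σℕ n (λ _ → Finite-× (card F _ , finite F _) (Finite-Assembly _ (Finite-𝕏⊙ rec)))
                   (Assembly-bound _ ∘ proj₂))

  -- Both sides times k! are (X·T)^k = X^k · T^k.
  Assembly-𝕏⊙ : ∀ k {n} → Assembly k (𝕏 ⊙ Tree F) n ↔ Split n (λ a b → (k ≡ a) × power (Tree F) k b)
  Assembly-𝕏⊙ k {n} = ×-cancelˡ-Fin (k !) {{k !≢0}}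
    (Finite-Assembly k (Finite-𝕏⊙ (λ {m} _ → Finite-Tree m)))
    (Finite-Split n λ {a} _ → Finite-×-dep (Finite-≡ k a) λ _ → Finite-power Finite-Tree k _)
    (↔-sym (power-sorted (λ { (_ , _ , [] , () , _) }) k)
     ⨾ power-⊙ k
     ⨾ Split-cong (λ _ → power-sorted (λ ()) k ×-↔ ↔-refl ⨾ Σ-assoc ⨾ ↔-refl ×-↔ (Assembly-𝕏 k ×-↔ ↔-refl))
     ⨾ Split-×ˡ)

  Tree↔Grafting : Tree F ≅ Grafting (obj F) (Tree F)
  Tree↔Grafting =
    Tree↔Σ-Assembly
    ⨾ Σ-cong (↔-refl ×-↔ Assembly-𝕏⊙ _ ⨾ ↔-sym Split-×ˡ)
    ⨾ ↔-sym Split-Σ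
    ⨾ Split-cong (λ _ → Σ-cong (∃∃↔∃∃ _) ⨾ ↔-sym (∃-≡ _))

  power-Tree : ∀ c → power (Tree F) c ≅ Grafting (power (obj F) c) (Tree F)
  power-Tree zero    = ↔-sym (Split-identityˡ _)
  power-Tree (suc c) = ⊙-cong Tree↔Grafting (power-Tree c) ⨾ Grafting-⊙

  Park-unfold : ∀ {χ n} → Park F χ n ↔
    (((n ≡ 0) × pow (obj F) (χ 1) 0) ⊎
     Σ (Subset n) λ V → (1 ≤ ∣ V ∣) × (pow (obj F) (χ 1) ∣ V ∣ × Park F (ρ χ ∣ V ∣) (n ∸ ∣ V ∣)))
  Park-unfold = mk↔ₛ′
    (λ { (base x) → inj₁ (refl , x) ; (step V p x y) → inj₂ (V , p , x , y) })
    (λ { (inj₁ (refl , x)) → base x ; (inj₂ (V , p , x , y)) → step V p x y })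
    (λ { (inj₁ (refl , _)) → refl ; (inj₂ _) → refl })
    (λ { (base _) → refl ; (step _ _ _ _) → refl })

  Park↔power : ∀ n {χ c} → ShiftedId c χ → Park F χ n ↔ power (Tree F) c n
  Park↔power = <-rec _ λ n rec {χ} {c} shifted →
    let pow≅power-c : ∀ a → pow (obj F) (χ 1) a ↔ power (obj F) c a
        pow≅power-c a = ↔-subst (λ x → pow (obj F) x a) (trans (shifted 0) (+-identityʳ c)) ⨾ pow≅power _ c
    in
    Park-unfold
    ⨾ (↔-refl ×-↔ pow≅power-c 0 ⨾ ×-comm _ _)
      ⊎-↔ (Subset↔Split n
           ⨾ Split-cong λ {a} s → Σ-cong λ {1≤a} →
               pow≅power-c a ×-↔ rec (shuffle-<ʳ s 1≤a) {ρ χ a} {a} (ρ-ShiftedId {χ = χ} shifted a))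
    ⨾ ↔-sym (Split-identityˡ n) ⊎-↔ ↔-refl
    ⨾ ↔-sym Split-⊎
    ⨾ ↔-sym (Split-cong λ {a} _ → ↔-zero-or-positive a)
    ⨾ ↔-sym (power-Tree c)

theorem2 : (F : Species) (n : ℕ) → ParkId F n ↔ Tree F n
theorem2 F n = Park↔power F n (λ _ → refl) ⨾ ⊙-identityʳ
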